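{- Let $\mathrm{ex}^{\mathrm{lin}}_3(n, C_4)$ denote the maximum number of hyperedges in a $3$-uniform linear hypergraph on $n$ vertices that contains no (Berge) cycle $C_4$ of length $4$. Then $$\mathrm{ex}^{\mathrm{lin}}_3(n, C_4) \le \frac{1}{6}\, n\sqrt{n+9} + \frac{n}{2} = \frac{n^{3/2}}{6} + O(n).$$
   Context: A hypergraph $H=(V,E)$ is $3$-uniform if every hyperedge is a $3$-element subset of $V$, and linear if any two distinct hyperedges share at most one vertex. A (Berge) cycle of length $k\ge 2$ in $H$ is an alternating sequence $v_1,h_1,v_2,h_2,\dots,v_k,h_k$ of distinct vertices $v_i$ and distinct hyperedges $h_i$ such that $v_i,v_{i+1}\in h_i$ for $1\le i\le k-1$ and $v_k,v_1\in h_k$. $H$ contains no $C_4$ means $H$ has no Berge cycle of length $4$. -}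

module Defs where

open import Data.Nat using (ℕ; _≤_; _*_; _+_; _∸_; _^_)
open import Data.Fin using (Fin)
open import Data.Fin.Subset using (Subset; ∣_∣; _∩_) renaming (_∈_ to _∈ₛ_)
open import Data.List using (List; length)
open import Data.List.Membership.Propositional using (_∈_)
open import Data.List.Relation.Unary.All using (All)
open import Data.List.Relation.Unary.Unique.Propositional using (Unique)
open import Relation.Nullary using (¬_)
open import Relation.Binary.PropositionalEquality using (_≡_; _≢_)

record Hypergraph3 (n : ℕ) : Set where
  field
    edges    : List (Subset n)
    distinct : Unique edges
    uniform  : All (λ e → ∣ e ∣ ≡ 3) edges
open Hypergraph3 public

numEdges : ∀ {n} → Hypergraph3 n → ℕ
numEdges H = length (edges H)

Linear : ∀ {n} → Hypergraph3 n → Set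
Linear H = ∀ {e f} → e ∈ edges H → f ∈ edges H → e ≢ f → ∣ e ∩ f ∣ ≤ 1

record BergeC4 {n : ℕ} (H : Hypergraph3 n) : Set where
  field
    v₁ v₂ v₃ v₄ : Fin n
    h₁ h₂ h₃ h₄ : Subset n
    v₁≢v₂ : v₁ ≢ v₂
    v₁≢v₃ : v₁ ≢ v₃
    v₁≢v₄ : v₁ ≢ v₄
    v₂≢v₃ : v₂ ≢ v₃
    v₂≢v₄ : v₂ ≢ v₄
    v₃≢v₄ : v₃ ≢ v₄
    h₁≢h₂ : h₁ ≢ h₂
    h₁≢h₃ : h₁ ≢ h₃
    h₁≢h₄ : h₁ ≢ h₄
    h₂≢h₃ : h₂ ≢ h₃
    h₂≢h₄ : h₂ ≢ h₄
    h₃≢h₄ : h₃ ≢ h₄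
    h₁∈H : h₁ ∈ edges H
    h₂∈H : h₂ ∈ edges H
    h₃∈H : h₃ ∈ edges H
    h₄∈H : h₄ ∈ edges H
    v₁∈h₁ : v₁ ∈ₛ h₁
    v₂∈h₁ : v₂ ∈ₛ h₁
    v₂∈h₂ : v₂ ∈ₛ h₂
    v₃∈h₂ : v₃ ∈ₛ h₂
    v₃∈h₃ : v₃ ∈ₛ h₃
    v₄∈h₃ : v₄ ∈ₛ h₃
    v₄∈h₄ : v₄ ∈ₛ h₄
    v₁∈h₄ : v₁ ∈ₛ h₄

C4Free : ∀ {n} → Hypergraph3 n → Set
C4Free H = ¬ BergeC4 H

-- The real inequality  m ≤ (1/6) n √(n+9) + n/2  for naturals m, n,
-- written exactly without reals: it is equivalent to 6m − 3n ≤ n √(n+9),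
-- i.e. (truncated) (6m ∸ 3n)² ≤ n² (n + 9).
BoundHolds : ℕ → ℕ → Set
BoundHolds n m = (6 * m ∸ 3 * n) ^ 2 ≤ n ^ 2 * (n + 9)

-- Double counting Berge paths x, eᵢ, v, eⱼ, y of length two.  With d the degree
-- function, Σ d = 3m and Σ d² = 3m + W, where W counts the wedges: a vertex with an
-- ordered pair of distinct edges through it; each wedge carries exactly 4 paths.
-- Call a path triangulated at its x-end when the third vertex of eᵢ meets y in some
-- edge other than eᵢ.  A path triangulated at neither end is determined by its
-- endpoints (two of them would close a C₄), so there are at most n² of those.  For an
-- edge eᵢ and an ordered pair (v, x) in it at most two y triangulate (three would give
-- a C₄ or four vertices in one edge), so at most 12m paths are triangulated at each
-- end.  Hence 4W ≤ n² + 24m, and Cauchy–Schwarz (3m)² ≤ n Σ d² yields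
-- (6m)² ≤ n³ + 36nm, that is (6m − 3n)² ≤ n²(n + 9).
module Submission where

open import Defs
open import Data.Nat using (ℕ; zero; suc; _+_; _*_; _∸_; _^_; _≤_; z≤n; s≤s)
open import Data.Nat.Properties
open import Data.Nat.Tactic.RingSolver using (solve-∀)
open import Data.Fin using (Fin; zero; suc)
open import Data.Fin.Properties using (any?)
  renaming (_≟_ to _≟ᶠ_; suc-injective to Fin-suc-injective)
open import Data.Fin.Subset using (Subset; ∣_∣; inside; outside) renaming (_∈_ to _∈ₛ_)
open import Data.Vec using ([]; _∷_; there)
open import Data.Fin.Subset.Properties using (_∈?_; x∈p∩q⁺)
open import Data.List using (List; []; _∷_; length; lookup)
open import Data.List.Membership.Propositional.Properties using (∈-lookup)
open import Data.List.Relation.Unary.All as All using (All; []; _∷_)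
open import Data.List.Relation.Unary.AllPairs using ([]; _∷_)
open import Data.List.Relation.Unary.Unique.Propositional using (Unique)
open import Data.Product using (∃-syntax; _×_; _,_; proj₁; proj₂; map₂)
open import Data.Sum using (_⊎_; inj₁; inj₂)
open import Data.Empty using (⊥; ⊥-elim)
open import Function using (_∘_)
open import Relation.Nullary using (Dec; yes; no; ¬_)
open import Relation.Nullary.Decidable using (_×-dec_; ¬?)
open import Relation.Unary using (Decidable)
open import Relation.Binary.PropositionalEquality
open import Algebra.Properties.Semiring.Sum +-*-semiring
  using (sum; sum-syntax; sum-cong-≗; ∑-distrib-+; ∑-comm; *-distribˡ-sum; *-distribʳ-sum)

private
  variable
    A B P Q : Set

𝟙 : Dec P → ℕ
𝟙 (yes _) = 1
𝟙 (no _)  = 0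

𝟙≤1 : (P? : Dec P) → 𝟙 P? ≤ 1
𝟙≤1 (yes _) = s≤s z≤n
𝟙≤1 (no _)  = z≤n

𝟙≡1 : (P? : Dec P) → P → 𝟙 P? ≡ 1
𝟙≡1 (yes _)  _ = refl
𝟙≡1 (no ¬p) p = ⊥-elim (¬p p)

𝟙≡0 : (P? : Dec P) → ¬ P → 𝟙 P? ≡ 0
𝟙≡0 (yes p) ¬p = ⊥-elim (¬p p)
𝟙≡0 (no _)  _  = refl

𝟙-cong : (P? : Dec P) (Q? : Dec Q) → (P → Q) → (Q → P) → 𝟙 P? ≡ 𝟙 Q?
𝟙-cong (yes _) (yes _) _ _ = refl
𝟙-cong (no _)  (no _)  _ _ = refl
𝟙-cong (yes p) (no ¬q) f _ = ⊥-elim (¬q (f p))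
𝟙-cong (no ¬p) (yes q) _ g = ⊥-elim (¬p (g q))

𝟙-× : (P? : Dec P) (Q? : Dec Q) → 𝟙 (P? ×-dec Q?) ≡ 𝟙 P? * 𝟙 Q?
𝟙-× (yes _) (yes _) = refl
𝟙-× (yes _) (no _)  = refl
𝟙-× (no _)  _       = refl

𝟙-yes-× : (p : P) (Q? : Dec Q) → 𝟙 (yes p ×-dec Q?) ≡ 𝟙 Q?
𝟙-yes-× _ (yes _) = refl
𝟙-yes-× _ (no _)  = refl

𝟙-split : (P? : Dec P) (Q? : Dec Q) → 𝟙 P? ≡ 𝟙 (P? ×-dec Q?) + 𝟙 (P? ×-dec ¬? Q?)
𝟙-split (yes _) (yes _) = refl
𝟙-split (yes _) (no _)  = refl
𝟙-split (no _)  _       = refl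

𝟙-cover : (P? : Dec P) (A? : Dec A) (B? : Dec B) →
          𝟙 P? ≤ 𝟙 (P? ×-dec ¬? A? ×-dec ¬? B?) + 𝟙 (P? ×-dec A?) + 𝟙 (P? ×-dec B?)
𝟙-cover (no _)  _       _       = z≤n
𝟙-cover (yes _) (yes _) _       = s≤s z≤n
𝟙-cover (yes _) (no _)  (yes _) = s≤s z≤n
𝟙-cover (yes _) (no _)  (no _)  = s≤s z≤n

sum-const : ∀ k c → ∑[ a < k ] c ≡ k * c
sum-const zero    c = refl
sum-const (suc k) c = cong (c +_) (sum-const k c)

sum-mono-≤ : ∀ {k} {f g : Fin k → ℕ} → (∀ a → f a ≤ g a) → sum f ≤ sum g
sum-mono-≤ {zero}  f≤g = z≤n
sum-mono-≤ {suc k} f≤g = +-mono-≤ (f≤g zero) (sum-mono-≤ (f≤g ∘ suc))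

∑𝟙≡0 : ∀ {k} {P : Fin k → Set} (P? : Decidable P) → (∀ a → ¬ P a) →
       ∑[ a < k ] 𝟙 (P? a) ≡ 0
∑𝟙≡0 {k} P? ∄P =
  trans (sum-cong-≗ (λ a → 𝟙≡0 (P? a) (∄P a))) (trans (sum-const k 0) (*-zeroʳ k))

∑𝟙-at : ∀ {k} {P : Fin k → Set} (P? : Decidable P) (i : Fin k) →
        ∑[ a < k ] 𝟙 (P? a ×-dec a ≟ᶠ i) ≡ 𝟙 (P? i)
∑𝟙-at P? zero = trans
  (cong₂ _+_ (𝟙-cong (P? zero ×-dec zero ≟ᶠ zero) (P? zero) proj₁ (_, refl))
             (∑𝟙≡0 (λ a → P? (suc a) ×-dec suc a ≟ᶠ zero) (λ { _ (_ , ()) })))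
  (+-identityʳ _)
∑𝟙-at P? (suc i) = cong₂ _+_
  (𝟙≡0 (P? zero ×-dec zero ≟ᶠ suc i) λ { (_ , ()) })
  (trans (sum-cong-≗ λ a → 𝟙-cong (P? (suc a) ×-dec suc a ≟ᶠ suc i) (P? (suc a) ×-dec a ≟ᶠ i)
                                  (map₂ Fin-suc-injective) (map₂ (cong suc)))
         (∑𝟙-at (P? ∘ suc) i))

∑𝟙-split-at : ∀ {k} {P : Fin k → Set} (P? : Decidable P) (i : Fin k) →
              ∑[ a < k ] 𝟙 (P? a) ≡ 𝟙 (P? i) + ∑[ a < k ] 𝟙 (P? a ×-dec ¬? (a ≟ᶠ i))
∑𝟙-split-at P? i = begin
    sum (𝟙 ∘ P?)
  ≡⟨ sum-cong-≗ (λ a → 𝟙-split (P? a) (a ≟ᶠ i)) ⟩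
    ∑[ a < _ ] (𝟙 (P? a ×-dec a ≟ᶠ i) + 𝟙 (P? a ×-dec ¬? (a ≟ᶠ i)))
  ≡⟨ ∑-distrib-+ (λ a → 𝟙 (P? a ×-dec a ≟ᶠ i)) (λ a → 𝟙 (P? a ×-dec ¬? (a ≟ᶠ i))) ⟩
    ∑[ a < _ ] 𝟙 (P? a ×-dec a ≟ᶠ i) + ∑[ a < _ ] 𝟙 (P? a ×-dec ¬? (a ≟ᶠ i))
  ≡⟨ cong (_+ ∑[ a < _ ] 𝟙 (P? a ×-dec ¬? (a ≟ᶠ i))) (∑𝟙-at P? i) ⟩
    𝟙 (P? i) + ∑[ a < _ ] 𝟙 (P? a ×-dec ¬? (a ≟ᶠ i)) ∎
  where open ≡-Reasoning

∑𝟙≡𝟙∃ : ∀ {k} {P : Fin k → Set} (P? : Decidable P) → (∀ {a b} → P a → P b → a ≡ b) →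
        ∑[ a < k ] 𝟙 (P? a) ≡ 𝟙 (any? P?)
∑𝟙≡𝟙∃ P? unique with any? P?
... | no ∄P       = ∑𝟙≡0 P? (λ a pa → ∄P (a , pa))
... | yes (i , pi) = trans (∑𝟙-split-at P? i)
  (cong₂ _+_ (𝟙≡1 (P? i) pi)
             (∑𝟙≡0 (λ a → P? a ×-dec ¬? (a ≟ᶠ i)) λ { a (pa , a≢i) → a≢i (unique pa pi) }))

∑𝟙≤2 : ∀ {k} {P : Fin k → Set} (P? : Decidable P) →
       (∀ {a b c} → P a → P b → P c → a ≢ b → a ≢ c → b ≢ c → ⊥) →
       ∑[ a < k ] 𝟙 (P? a) ≤ 2
∑𝟙≤2 {P = P} P? no-three with any? P?
... | no ∄P = subst (_≤ 2) (sym (∑𝟙≡0 P? λ a pa → ∄P (a , pa))) z≤n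
... | yes (a , pa) = subst (_≤ 2) (sym (∑𝟙-split-at P? a))
  (+-mono-≤ (𝟙≤1 (P? a)) (subst (_≤ 1) (sym (∑𝟙≡𝟙∃ P≢a? unique)) (𝟙≤1 (any? P≢a?))))
  where
  P≢a? = λ b → P? b ×-dec ¬? (b ≟ᶠ a)
  unique : ∀ {b c} → P b × b ≢ a → P c × c ≢ a → b ≡ c
  unique {b} {c} (pb , b≢a) (pc , c≢a) with b ≟ᶠ c
  ... | yes b≡c = b≡c
  ... | no b≢c  = ⊥-elim (no-three pa pb pc (≢-sym b≢a) (≢-sym c≢a) b≢c)

distinct⇒length≤∑𝟙 : ∀ {k} {P : Fin k → Set} (P? : Decidable P) {xs : List (Fin k)} →
                     Unique xs → All P xs → length xs ≤ ∑[ a < k ] 𝟙 (P? a)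
distinct⇒length≤∑𝟙 P? []               []         = z≤n
distinct⇒length≤∑𝟙 P? {x ∷ xs} (x∉xs ∷ xs!) (px ∷ pxs) = begin
    suc (length xs)
  ≤⟨ s≤s (distinct⇒length≤∑𝟙 (λ a → P? a ×-dec ¬? (a ≟ᶠ x)) xs!
                             (All.zip (pxs , All.map ≢-sym x∉xs))) ⟩
    1 + ∑[ a < _ ] 𝟙 (P? a ×-dec ¬? (a ≟ᶠ x))
  ≡⟨ cong (_+ ∑[ a < _ ] 𝟙 (P? a ×-dec ¬? (a ≟ᶠ x))) (𝟙≡1 (P? x) px) ⟨
    𝟙 (P? x) + ∑[ a < _ ] 𝟙 (P? a ×-dec ¬? (a ≟ᶠ x))
  ≡⟨ ∑𝟙-split-at P? x ⟨
    sum (𝟙 ∘ P?) ∎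
  where open ≤-Reasoning

𝟙-suc∈?∷ : ∀ {k} s (p : Subset k) x → 𝟙 (suc x ∈? s ∷ p) ≡ 𝟙 (x ∈? p)
𝟙-suc∈?∷ s p x = 𝟙-cong (suc x ∈? s ∷ p) (x ∈? p) (λ { (there x∈p) → x∈p }) there

∣p∣≡∑𝟙∈ : ∀ {k} (p : Subset k) → ∣ p ∣ ≡ ∑[ x < k ] 𝟙 (x ∈? p)
∣p∣≡∑𝟙∈ []            = refl
∣p∣≡∑𝟙∈ (inside ∷ p)  = cong suc (trans (∣p∣≡∑𝟙∈ p) (sym (sum-cong-≗ (𝟙-suc∈?∷ inside p))))
∣p∣≡∑𝟙∈ (outside ∷ p) = trans (∣p∣≡∑𝟙∈ p) (sym (sum-cong-≗ (𝟙-suc∈?∷ outside p)))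

∣p∣≡1+∣p-x∣ : ∀ {k} {x : Fin k} (p : Subset k) → x ∈ₛ p →
              ∣ p ∣ ≡ 1 + ∑[ y < k ] 𝟙 (y ∈? p ×-dec ¬? (y ≟ᶠ x))
∣p∣≡1+∣p-x∣ {x = x} p x∈p =
  trans (∣p∣≡∑𝟙∈ p) (trans (∑𝟙-split-at (_∈? p) x)
    (cong (_+ ∑[ y < _ ] 𝟙 (y ∈? p ×-dec ¬? (y ≟ᶠ x))) (𝟙≡1 (x ∈? p) x∈p)))

distinct-elements≤∣p∣ : ∀ {k} {p : Subset k} {xs : List (Fin k)} →
                        Unique xs → All (_∈ₛ p) xs → length xs ≤ ∣ p ∣
distinct-elements≤∣p∣ {p = p} {xs} xs! xs⊆p =
  subst (length xs ≤_) (sym (∣p∣≡∑𝟙∈ p)) (distinct⇒length≤∑𝟙 (_∈? p) xs! xs⊆p)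

lookup-injective : ∀ {A : Set} {xs : List A} → Unique xs →
                   ∀ {i j} → lookup xs i ≡ lookup xs j → i ≡ j
lookup-injective (x∉xs ∷ _)   {zero}  {zero}  _  = refl
lookup-injective (x∉xs ∷ _)   {zero}  {suc j} eq = ⊥-elim (All.lookup x∉xs (∈-lookup j) eq)
lookup-injective (x∉xs ∷ _)   {suc i} {zero}  eq = ⊥-elim (All.lookup x∉xs (∈-lookup i) (sym eq))
lookup-injective (_ ∷ xs!)    {suc i} {suc j} eq = cong suc (lookup-injective xs! eq)

2a[a+c]≤a²+[a+c]² : ∀ a c → 2 * (a * (a + c)) ≤ a * a + (a + c) * (a + c)
2a[a+c]≤a²+[a+c]² a c =
  subst (2 * (a * (a + c)) ≤_) (sym (expand a c)) (m≤m+n (2 * (a * (a + c))) (c * c))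
  where
  expand : ∀ a c → a * a + (a + c) * (a + c) ≡ 2 * (a * (a + c)) + c * c
  expand = solve-∀

2ab≤a²+b² : ∀ a b → 2 * (a * b) ≤ a * a + b * b
2ab≤a²+b² a b with ≤-total a b
... | inj₁ a≤b =
  subst (λ b → 2 * (a * b) ≤ a * a + b * b) (m+[n∸m]≡n a≤b) (2a[a+c]≤a²+[a+c]² a (b ∸ a))
... | inj₂ b≤a = subst₂ _≤_ (cong (2 *_) (*-comm b a)) (+-comm (b * b) (a * a))
  (subst (λ a → 2 * (b * a) ≤ b * b + a * a) (m+[n∸m]≡n b≤a) (2a[a+c]≤a²+[a+c]² b (a ∸ b)))

sum*sum≡∑∑ : ∀ {k l} (f : Fin k → ℕ) (g : Fin l → ℕ) → sum f * sum g ≡ ∑[ a < k ] ∑[ b < l ] (f a * g b)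
sum*sum≡∑∑ f g = trans (*-distribʳ-sum (sum g) f) (sum-cong-≗ λ a → *-distribˡ-sum (f a) g)

cauchy-schwarz : ∀ k (g : Fin k → ℕ) → sum g * sum g ≤ k * ∑[ a < k ] (g a * g a)
cauchy-schwarz k g = *-cancelˡ-≤ 2 (begin
    2 * (sum g * sum g)
  ≡⟨ cong (2 *_) (sum*sum≡∑∑ g g) ⟩
    2 * ∑[ a < k ] ∑[ b < k ] (g a * g b)
  ≡⟨ trans (*-distribˡ-sum 2 (λ a → ∑[ b < k ] (g a * g b)))
           (sum-cong-≗ λ a → *-distribˡ-sum 2 (λ b → g a * g b)) ⟩
    ∑[ a < k ] ∑[ b < k ] (2 * (g a * g b))
  ≤⟨ sum-mono-≤ (λ a → sum-mono-≤ λ b → 2ab≤a²+b² (g a) (g b)) ⟩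
    ∑[ a < k ] ∑[ b < k ] (g a * g a + g b * g b)
  ≡⟨ trans (sum-cong-≗ λ a → ∑-distrib-+ (λ b → g a * g a) (λ b → g b * g b))
           (∑-distrib-+ (λ a → ∑[ b < k ] (g a * g a)) (λ a → S)) ⟩
    ∑[ a < k ] ∑[ b < k ] (g a * g a) + ∑[ a < k ] S
  ≡⟨ cong₂ _+_ (trans (sum-cong-≗ λ a → sum-const k (g a * g a)) (sym (*-distribˡ-sum k (λ a → g a * g a))))
               (sum-const k S) ⟩
    k * S + k * S
  ≡⟨ cong (k * S +_) (+-identityʳ (k * S)) ⟨
    2 * (k * S) ∎)
  where
  open ≤-Reasoning
  S = ∑[ a < k ] (g a * g a)

completing-the-square : ∀ n M → M * M ≤ n * n * n + 6 * n * M → (M ∸ 3 * n) ^ 2 ≤ n ^ 2 * (n + 9)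
completing-the-square n M M²≤ with ≤-total M (3 * n)
... | inj₁ M≤3n rewrite m≤n⇒m∸n≡0 M≤3n = z≤n
... | inj₂ 3n≤M = +-cancelʳ-≤ (6 * a * n + 9 * (n * n)) _ _ (begin
    a ^ 2 + (6 * a * n + 9 * (n * n)) ≡⟨ square a n ⟨
    (a + 3 * n) * (a + 3 * n)         ≡⟨ cong (λ t → t * t) M≡a+3n ⟨
    M * M                             ≤⟨ M²≤ ⟩
    n * n * n + 6 * n * M             ≡⟨ cong (λ t → n * n * n + 6 * n * t) M≡a+3n ⟩
    n * n * n + 6 * n * (a + 3 * n)   ≡⟨ cube n a ⟩
    n ^ 2 * (n + 9) + (6 * a * n + 9 * (n * n)) ∎)
  where
  open ≤-Reasoning
  a = M ∸ 3 * n
  M≡a+3n : M ≡ a + 3 * n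
  M≡a+3n = sym (m∸n+n≡m 3n≤M)
  -- a * (a * 1) and n * (n * 1) are a ^ 2 and n ^ 2 unfolded, which the solver cannot parse.
  square : ∀ a n → (a + 3 * n) * (a + 3 * n) ≡ a * (a * 1) + (6 * a * n + 9 * (n * n))
  square = solve-∀
  cube : ∀ n a → n * n * n + 6 * n * (a + 3 * n) ≡ n * (n * 1) * (n + 9) + (6 * a * n + 9 * (n * n))
  cube = solve-∀

module _ {n} (H : Hypergraph3 n) where

  m : ℕ
  m = numEdges H

  edge : Fin m → Subset n
  edge = lookup (edges H)

  edge-injective : ∀ {i j} → edge i ≡ edge j → i ≡ j
  edge-injective = lookup-injective (distinct H)

  ∣edge∣≡3 : ∀ i → ∣ edge i ∣ ≡ 3
  ∣edge∣≡3 i = All.lookup (uniform H) (∈-lookup i)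

  edge-has-no-four-distinct-vertices : ∀ i {a b c d} →
    a ∈ₛ edge i → b ∈ₛ edge i → c ∈ₛ edge i → d ∈ₛ edge i →
    a ≢ b → a ≢ c → a ≢ d → b ≢ c → b ≢ d → c ≢ d → ⊥
  edge-has-no-four-distinct-vertices i a∈ b∈ c∈ d∈ a≢b a≢c a≢d b≢c b≢d c≢d =
    1+n≰n (subst (4 ≤_) (∣edge∣≡3 i)
      (distinct-elements≤∣p∣ ((a≢b ∷ a≢c ∷ a≢d ∷ []) ∷ (b≢c ∷ b≢d ∷ []) ∷ (c≢d ∷ []) ∷ [] ∷ [])
                             (a∈ ∷ b∈ ∷ c∈ ∷ d∈ ∷ [])))

  bergeC4 : ∀ {a b c d} (i j k l : Fin m) →
    a ≢ b → a ≢ c → a ≢ d → b ≢ c → b ≢ d → c ≢ d →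
    i ≢ j → i ≢ k → i ≢ l → j ≢ k → j ≢ l → k ≢ l →
    a ∈ₛ edge i → b ∈ₛ edge i → b ∈ₛ edge j → c ∈ₛ edge j →
    c ∈ₛ edge k → d ∈ₛ edge k → d ∈ₛ edge l → a ∈ₛ edge l → BergeC4 H
  bergeC4 i j k l a≢b a≢c a≢d b≢c b≢d c≢d i≢j i≢k i≢l j≢k j≢l k≢l a∈i b∈i b∈j c∈j c∈k d∈k d∈l a∈l =
    record
      { v₁≢v₂ = a≢b ; v₁≢v₃ = a≢c ; v₁≢v₄ = a≢d ; v₂≢v₃ = b≢c ; v₂≢v₄ = b≢d ; v₃≢v₄ = c≢d
      ; h₁≢h₂ = i≢j ∘ edge-injective ; h₁≢h₃ = i≢k ∘ edge-injective ; h₁≢h₄ = i≢l ∘ edge-injective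
      ; h₂≢h₃ = j≢k ∘ edge-injective ; h₂≢h₄ = j≢l ∘ edge-injective ; h₃≢h₄ = k≢l ∘ edge-injective
      ; h₁∈H = ∈-lookup i ; h₂∈H = ∈-lookup j ; h₃∈H = ∈-lookup k ; h₄∈H = ∈-lookup l
      ; v₁∈h₁ = a∈i ; v₂∈h₁ = b∈i ; v₂∈h₂ = b∈j ; v₃∈h₂ = c∈j
      ; v₃∈h₃ = c∈k ; v₄∈h₃ = d∈k ; v₄∈h₄ = d∈l ; v₁∈h₄ = a∈l }

  degree : Fin n → ℕ
  degree v = ∑[ i < m ] 𝟙 (v ∈? edge i)

  Wedge : Fin n → Fin m → Fin m → Set
  Wedge v i j = v ∈ₛ edge i × v ∈ₛ edge j × i ≢ j

  wedge? : ∀ v i j → Dec (Wedge v i j)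
  wedge? v i j = v ∈? edge i ×-dec v ∈? edge j ×-dec ¬? (i ≟ᶠ j)

  OtherIn : Fin m → Fin n → Fin n → Set
  OtherIn i v x = x ∈ₛ edge i × x ≢ v

  otherIn? : ∀ i v x → Dec (OtherIn i v x)
  otherIn? i v x = x ∈? edge i ×-dec ¬? (x ≟ᶠ v)

  Path : Fin n → Fin m → Fin m → Fin n → Fin n → Set
  Path v i j x y = Wedge v i j × OtherIn i v x × OtherIn j v y

  path? : ∀ v i j x y → Dec (Path v i j x y)
  path? v i j x y = wedge? v i j ×-dec otherIn? i v x ×-dec otherIn? j v y

  Triangulated : Fin n → Fin m → Fin n → Fin n → Set
  Triangulated v i x y =
    ∃[ w ] ∃[ k ] (OtherIn i v w × w ≢ x × w ∈ₛ edge k × y ∈ₛ edge k × k ≢ i)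

  triangulated? : ∀ v i x y → Dec (Triangulated v i x y)
  triangulated? v i x y = any? λ w → any? λ k →
    otherIn? i v w ×-dec ¬? (w ≟ᶠ x) ×-dec w ∈? edge k ×-dec y ∈? edge k ×-dec ¬? (k ≟ᶠ i)

  GoodPath LeftPath RightPath : Fin n → Fin m → Fin m → Fin n → Fin n → Set
  GoodPath  v i j x y = Path v i j x y × ¬ Triangulated v i x y × ¬ Triangulated v j y x
  LeftPath  v i j x y = Path v i j x y × Triangulated v i x y
  RightPath v i j x y = Path v i j x y × Triangulated v j y x

  good? : ∀ v i j x y → Dec (GoodPath v i j x y)
  good? v i j x y = path? v i j x y ×-dec ¬? (triangulated? v i x y) ×-dec ¬? (triangulated? v j y x)

  left? : ∀ v i j x y → Dec (LeftPath v i j x y)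
  left? v i j x y = path? v i j x y ×-dec triangulated? v i x y

  right? : ∀ v i j x y → Dec (RightPath v i j x y)
  right? v i j x y = path? v i j x y ×-dec triangulated? v j y x

  ∑⁵ : (Fin n → Fin m → Fin m → Fin n → Fin n → ℕ) → ℕ
  ∑⁵ F = ∑[ v < n ] ∑[ i < m ] ∑[ j < m ] ∑[ x < n ] ∑[ y < n ] F v i j x y

  ∑⁵-mono-≤ : ∀ {F G} → (∀ v i j x y → F v i j x y ≤ G v i j x y) → ∑⁵ F ≤ ∑⁵ G
  ∑⁵-mono-≤ F≤G = sum-mono-≤ λ v → sum-mono-≤ λ i → sum-mono-≤ λ j →
                  sum-mono-≤ λ x → sum-mono-≤ λ y → F≤G v i j x y

  ∑⁵-distrib-+ : ∀ F G → ∑⁵ (λ v i j x y → F v i j x y + G v i j x y) ≡ ∑⁵ F + ∑⁵ G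
  ∑⁵-distrib-+ F G =
    trans (sum-cong-≗ λ v → trans (sum-cong-≗ λ i → trans (sum-cong-≗ λ j → trans (sum-cong-≗ λ x →
      ∑-distrib-+ (F v i j x) (G v i j x))
      (∑-distrib-+ (λ x → ∑[ y < n ] F v i j x y) (λ x → ∑[ y < n ] G v i j x y)))
      (∑-distrib-+ (λ j → ∑[ x < n ] ∑[ y < n ] F v i j x y) (λ j → ∑[ x < n ] ∑[ y < n ] G v i j x y)))
      (∑-distrib-+ (λ i → ∑[ j < m ] ∑[ x < n ] ∑[ y < n ] F v i j x y)
                   (λ i → ∑[ j < m ] ∑[ x < n ] ∑[ y < n ] G v i j x y)))
      (∑-distrib-+ (λ v → ∑[ i < m ] ∑[ j < m ] ∑[ x < n ] ∑[ y < n ] F v i j x y)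
                   (λ v → ∑[ i < m ] ∑[ j < m ] ∑[ x < n ] ∑[ y < n ] G v i j x y))

  ∑⁵-by-endpoints : ∀ F → ∑⁵ F ≡ ∑[ x < n ] ∑[ y < n ] ∑[ v < n ] ∑[ i < m ] ∑[ j < m ] F v i j x y
  ∑⁵-by-endpoints F = begin
      ∑⁵ F
    ≡⟨ (sum-cong-≗ λ v → sum-cong-≗ λ i → ∑-comm λ j x → ∑[ y < n ] F v i j x y) ⟩
      ∑[ v < n ] ∑[ i < m ] ∑[ x < n ] ∑[ j < m ] ∑[ y < n ] F v i j x y
    ≡⟨ (sum-cong-≗ λ v → sum-cong-≗ λ i → sum-cong-≗ λ x → ∑-comm λ j y → F v i j x y) ⟩
      ∑[ v < n ] ∑[ i < m ] ∑[ x < n ] ∑[ y < n ] ∑[ j < m ] F v i j x y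
    ≡⟨ (sum-cong-≗ λ v → ∑-comm λ i x → ∑[ y < n ] ∑[ j < m ] F v i j x y) ⟩
      ∑[ v < n ] ∑[ x < n ] ∑[ i < m ] ∑[ y < n ] ∑[ j < m ] F v i j x y
    ≡⟨ (sum-cong-≗ λ v → sum-cong-≗ λ x → ∑-comm λ i y → ∑[ j < m ] F v i j x y) ⟩
      ∑[ v < n ] ∑[ x < n ] ∑[ y < n ] ∑[ i < m ] ∑[ j < m ] F v i j x y
    ≡⟨ ∑-comm (λ v x → ∑[ y < n ] ∑[ i < m ] ∑[ j < m ] F v i j x y) ⟩
      ∑[ x < n ] ∑[ v < n ] ∑[ y < n ] ∑[ i < m ] ∑[ j < m ] F v i j x y
    ≡⟨ (sum-cong-≗ λ x → ∑-comm λ v y → ∑[ i < m ] ∑[ j < m ] F v i j x y) ⟩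
      ∑[ x < n ] ∑[ y < n ] ∑[ v < n ] ∑[ i < m ] ∑[ j < m ] F v i j x y ∎
    where open ≡-Reasoning

  ∑⁵-by-first-edge : ∀ F → ∑⁵ F ≡ ∑[ i < m ] ∑[ v < n ] ∑[ x < n ] ∑[ y < n ] ∑[ j < m ] F v i j x y
  ∑⁵-by-first-edge F = begin
      ∑⁵ F
    ≡⟨ (sum-cong-≗ λ v → sum-cong-≗ λ i → ∑-comm λ j x → ∑[ y < n ] F v i j x y) ⟩
      ∑[ v < n ] ∑[ i < m ] ∑[ x < n ] ∑[ j < m ] ∑[ y < n ] F v i j x y
    ≡⟨ (sum-cong-≗ λ v → sum-cong-≗ λ i → sum-cong-≗ λ x → ∑-comm λ j y → F v i j x y) ⟩
      ∑[ v < n ] ∑[ i < m ] ∑[ x < n ] ∑[ y < n ] ∑[ j < m ] F v i j x y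
    ≡⟨ ∑-comm (λ v i → ∑[ x < n ] ∑[ y < n ] ∑[ j < m ] F v i j x y) ⟩
      ∑[ i < m ] ∑[ v < n ] ∑[ x < n ] ∑[ y < n ] ∑[ j < m ] F v i j x y ∎
    where open ≡-Reasoning

  ∑⁵-swap-ends : ∀ F → ∑⁵ (λ v i j x y → F v j i y x) ≡ ∑⁵ F
  ∑⁵-swap-ends F = trans
    (sum-cong-≗ λ v → ∑-comm λ i j → ∑[ x < n ] ∑[ y < n ] F v j i y x)
    (sum-cong-≗ λ v → sum-cong-≗ λ j → sum-cong-≗ λ i → ∑-comm λ x y → F v j i y x)

  #paths #good #left #right #wedges : ℕ
  #paths = ∑⁵ λ v i j x y → 𝟙 (path? v i j x y)
  #good  = ∑⁵ λ v i j x y → 𝟙 (good? v i j x y)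
  #left  = ∑⁵ λ v i j x y → 𝟙 (left? v i j x y)
  #right = ∑⁵ λ v i j x y → 𝟙 (right? v i j x y)
  #wedges = ∑[ v < n ] ∑[ i < m ] ∑[ j < m ] 𝟙 (wedge? v i j)

  others-in-edge≡2 : ∀ {v i} → v ∈ₛ edge i → ∑[ x < n ] 𝟙 (otherIn? i v x) ≡ 2
  others-in-edge≡2 {v} {i} v∈i = suc-injective (trans (sym (∣p∣≡1+∣p-x∣ (edge i) v∈i)) (∣edge∣≡3 i))

  ∑degree≡m*3 : ∑[ v < n ] degree v ≡ m * 3
  ∑degree≡m*3 = trans (∑-comm (λ v i → 𝟙 (v ∈? edge i)))
    (trans (sum-cong-≗ λ i → trans (sym (∣p∣≡∑𝟙∈ (edge i))) (∣edge∣≡3 i)) (sum-const m 3))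

  degree²≡degree+wedges : ∀ v → degree v * degree v ≡ degree v + ∑[ i < m ] ∑[ j < m ] 𝟙 (wedge? v i j)
  degree²≡degree+wedges v = begin
      degree v * degree v
    ≡⟨ sum*sum≡∑∑ (λ i → 𝟙 (v ∈? edge i)) (λ j → 𝟙 (v ∈? edge j)) ⟩
      ∑[ i < m ] ∑[ j < m ] (𝟙 (v ∈? edge i) * 𝟙 (v ∈? edge j))
    ≡⟨ (sum-cong-≗ λ i → sum-cong-≗ λ j → sym (𝟙-× (v ∈? edge i) (v ∈? edge j))) ⟩
      ∑[ i < m ] ∑[ j < m ] 𝟙 (v ∈? edge i ×-dec v ∈? edge j)
    ≡⟨ (sum-cong-≗ λ i → trans (∑𝟙-split-at (λ j → v ∈? edge i ×-dec v ∈? edge j) i)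
         (cong₂ _+_ (𝟙-cong (v ∈? edge i ×-dec v ∈? edge i) (v ∈? edge i) proj₁ (λ v∈i → v∈i , v∈i))
                    (sum-cong-≗ λ j → 𝟙-cong ((v ∈? edge i ×-dec v ∈? edge j) ×-dec ¬? (j ≟ᶠ i)) (wedge? v i j)
                       (λ { ((v∈i , v∈j) , j≢i) → v∈i , v∈j , ≢-sym j≢i })
                       (λ { (v∈i , v∈j , i≢j) → (v∈i , v∈j) , ≢-sym i≢j })))) ⟩
      ∑[ i < m ] (𝟙 (v ∈? edge i) + ∑[ j < m ] 𝟙 (wedge? v i j))
    ≡⟨ ∑-distrib-+ (λ i → 𝟙 (v ∈? edge i)) (λ i → ∑[ j < m ] 𝟙 (wedge? v i j)) ⟩
      degree v + ∑[ i < m ] ∑[ j < m ] 𝟙 (wedge? v i j) ∎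
    where open ≡-Reasoning

  ∑degree²≡m*3+#wedges : ∑[ v < n ] (degree v * degree v) ≡ m * 3 + #wedges
  ∑degree²≡m*3+#wedges =
    trans (sum-cong-≗ degree²≡degree+wedges)
          (trans (∑-distrib-+ degree (λ v → ∑[ i < m ] ∑[ j < m ] 𝟙 (wedge? v i j)))
                 (cong (_+ #wedges) ∑degree≡m*3))

  paths-on-wedge : ∀ v i j → ∑[ x < n ] ∑[ y < n ] 𝟙 (path? v i j x y) ≡ 𝟙 (wedge? v i j) * 4
  paths-on-wedge v i j = count (wedge? v i j)
    where
    count : (wedge? : Dec (Wedge v i j)) →
            ∑[ x < n ] ∑[ y < n ] 𝟙 (wedge? ×-dec otherIn? i v x ×-dec otherIn? j v y) ≡ 𝟙 wedge? * 4
    count (no ¬wedge) =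
      trans (sum-cong-≗ λ x → ∑𝟙≡0 (λ y → no ¬wedge ×-dec otherIn? i v x ×-dec otherIn? j v y)
                                   λ y → ¬wedge ∘ proj₁)
            (trans (sum-const n 0) (*-zeroʳ n))
    count (yes wedge@(v∈i , v∈j , _)) = begin
        ∑[ x < n ] ∑[ y < n ] 𝟙 (yes wedge ×-dec otherIn? i v x ×-dec otherIn? j v y)
      ≡⟨ (sum-cong-≗ λ x → sum-cong-≗ λ y →
           trans (𝟙-yes-× wedge _) (𝟙-× (otherIn? i v x) (otherIn? j v y))) ⟩
        ∑[ x < n ] ∑[ y < n ] (𝟙 (otherIn? i v x) * 𝟙 (otherIn? j v y))
      ≡⟨ sum*sum≡∑∑ (λ x → 𝟙 (otherIn? i v x)) (λ y → 𝟙 (otherIn? j v y)) ⟨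
        ∑[ x < n ] 𝟙 (otherIn? i v x) * ∑[ y < n ] 𝟙 (otherIn? j v y)
      ≡⟨ cong₂ _*_ (others-in-edge≡2 v∈i) (others-in-edge≡2 v∈j) ⟩
        4 ∎
      where open ≡-Reasoning

  #paths≡#wedges*4 : #paths ≡ #wedges * 4
  #paths≡#wedges*4 = sym
    (trans (*-distribʳ-sum 4 (λ v → ∑[ i < m ] ∑[ j < m ] 𝟙 (wedge? v i j))) (sum-cong-≗ λ v →
     trans (*-distribʳ-sum 4 (λ i → ∑[ j < m ] 𝟙 (wedge? v i j))) (sum-cong-≗ λ i →
     trans (*-distribʳ-sum 4 (λ j → 𝟙 (wedge? v i j))) (sum-cong-≗ λ j →
     sym (paths-on-wedge v i j)))))

  #paths≤#good+#left+#right : #paths ≤ #good + #left + #right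
  #paths≤#good+#left+#right = begin
      #paths
    ≤⟨ (∑⁵-mono-≤ λ v i j x y → 𝟙-cover (path? v i j x y) (triangulated? v i x y) (triangulated? v j y x)) ⟩
      ∑⁵ (λ v i j x y → 𝟙 (good? v i j x y) + 𝟙 (left? v i j x y) + 𝟙 (right? v i j x y))
    ≡⟨ trans (∑⁵-distrib-+ _ _) (cong (_+ #right) (∑⁵-distrib-+ _ _)) ⟩
      #good + #left + #right ∎
    where open ≤-Reasoning

  #right≡#left : #right ≡ #left
  #right≡#left = trans
    (sym (∑⁵-swap-ends λ v i j x y → 𝟙 (right? v i j x y)))
    (sum-cong-≗ λ v → sum-cong-≗ λ i → sum-cong-≗ λ j → sum-cong-≗ λ x → sum-cong-≗ λ y →
      𝟙-cong (right? v j i y x) (left? v i j x y) mirror mirror)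
    where
    mirror : ∀ {v i j x y} {T : Set} → Path v i j x y × T → Path v j i y x × T
    mirror (((v∈i , v∈j , i≢j) , x-other , y-other) , t) = ((v∈j , v∈i , ≢-sym i≢j) , y-other , x-other) , t

  ordered-pairs-in-edge≡6 : ∀ i → ∑[ v < n ] ∑[ x < n ] 𝟙 (v ∈? edge i ×-dec otherIn? i v x) ≡ 6
  ordered-pairs-in-edge≡6 i = begin
      ∑[ v < n ] ∑[ x < n ] 𝟙 (v ∈? edge i ×-dec otherIn? i v x)
    ≡⟨ sum-cong-≗ (λ v → partners v (v ∈? edge i)) ⟩
      ∑[ v < n ] (𝟙 (v ∈? edge i) * 2)
    ≡⟨ *-distribʳ-sum 2 (λ v → 𝟙 (v ∈? edge i)) ⟨
      (∑[ v < n ] 𝟙 (v ∈? edge i)) * 2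
    ≡⟨ cong (_* 2) (trans (sym (∣p∣≡∑𝟙∈ (edge i))) (∣edge∣≡3 i)) ⟩
      6 ∎
    where
    open ≡-Reasoning
    partners : ∀ v (v∈? : Dec (v ∈ₛ edge i)) → ∑[ x < n ] 𝟙 (v∈? ×-dec otherIn? i v x) ≡ 𝟙 v∈? * 2
    partners v (yes v∈i) = trans (sum-cong-≗ λ x → 𝟙-yes-× v∈i (otherIn? i v x)) (others-in-edge≡2 v∈i)
    partners v (no v∉i)  = ∑𝟙≡0 (λ x → no v∉i ×-dec otherIn? i v x) λ x → v∉i ∘ proj₁

  module _ (linear : Linear H) where

    two-common-vertices⇒≡ : ∀ {a b i j} → a ∈ₛ edge i → b ∈ₛ edge i → a ∈ₛ edge j → b ∈ₛ edge j →
                            a ≢ b → i ≡ j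
    two-common-vertices⇒≡ {i = i} {j} a∈i b∈i a∈j b∈j a≢b with i ≟ᶠ j
    ... | yes i≡j = i≡j
    ... | no i≢j  = ⊥-elim (1+n≰n (≤-trans
      (distinct-elements≤∣p∣ ((a≢b ∷ []) ∷ [] ∷ []) (x∈p∩q⁺ (a∈i , a∈j) ∷ x∈p∩q⁺ (b∈i , b∈j) ∷ []))
      (linear (∈-lookup i) (∈-lookup j) (i≢j ∘ edge-injective))))

    module _ (c4-free : C4Free H) where

      good-path-unique : ∀ {v i j v′ i′ j′ x y} → GoodPath v i j x y → GoodPath v′ i′ j′ x y →
                         v ≡ v′ × i ≡ i′ × j ≡ j′
      good-path-unique {v} {i} {j} {v′} {i′} {j′} {x} {y}
        (((v∈i , v∈j , i≢j) , (x∈i , x≢v) , (y∈j , y≢v)) , ¬tri , ¬tri-end)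
        (((v′∈i′ , v′∈j′ , i′≢j′) , (x∈i′ , x≢v′) , (y∈j′ , y≢v′)) , _ , _) with v ≟ᶠ v′
      ... | yes refl = refl , two-common-vertices⇒≡ v∈i x∈i v′∈i′ x∈i′ (≢-sym x≢v)
                            , two-common-vertices⇒≡ v∈j y∈j v′∈j′ y∈j′ (≢-sym y≢v)
      ... | no v≢v′ with i ≟ᶠ i′
      ...   | yes refl = ⊥-elim
        (¬tri (v′ , j′ , (v′∈i′ , ≢-sym v≢v′) , ≢-sym x≢v′ , v′∈j′ , y∈j′ , ≢-sym i′≢j′))
      ...   | no i≢i′ with j ≟ᶠ j′
      ...     | yes refl = ⊥-elim
        (¬tri-end (v′ , i′ , (v′∈j′ , ≢-sym v≢v′) , ≢-sym y≢v′ , v′∈i′ , x∈i′ , i′≢j′))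
      ...     | no j≢j′  = ⊥-elim (c4-free (bergeC4 i j j′ i′
          x≢v x≢y x≢v′ (≢-sym y≢v) v≢v′ y≢v′
          i≢j i≢j′ i≢i′ j≢j′ j≢i′ (≢-sym i′≢j′)
          x∈i v∈i v∈j y∈j y∈j′ v′∈j′ v′∈i′ x∈i′))
        where
        x≢y : x ≢ y
        x≢y refl = i≢j (two-common-vertices⇒≡ v∈i x∈i v∈j y∈j (≢-sym x≢v))
        i≢j′ : i ≢ j′
        i≢j′ refl = i≢j (two-common-vertices⇒≡ v∈i y∈j′ v∈j y∈j (≢-sym y≢v))
        j≢i′ : j ≢ i′
        j≢i′ refl = i≢j (two-common-vertices⇒≡ v∈i x∈i v∈j x∈i′ (≢-sym x≢v))

      #good≤n*n : #good ≤ n * n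
      #good≤n*n = begin
          #good
        ≡⟨ ∑⁵-by-endpoints _ ⟩
          ∑[ x < n ] ∑[ y < n ] ∑[ v < n ] ∑[ i < m ] ∑[ j < m ] 𝟙 (good? v i j x y)
        ≤⟨ (sum-mono-≤ λ x → sum-mono-≤ λ y → at-most-one x y) ⟩
          ∑[ x < n ] ∑[ y < n ] 1
        ≡⟨ sum-cong-≗ {n} (λ x → trans (sum-const n 1) (*-identityʳ n)) ⟩
          ∑[ x < n ] n
        ≡⟨ sum-const n n ⟩
          n * n ∎
        where
        open ≤-Reasoning
        at-most-one : ∀ x y → ∑[ v < n ] ∑[ i < m ] ∑[ j < m ] 𝟙 (good? v i j x y) ≤ 1
        at-most-one x y = begin
            ∑[ v < n ] ∑[ i < m ] ∑[ j < m ] 𝟙 (good? v i j x y)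
          ≡⟨ (sum-cong-≗ λ v → sum-cong-≗ λ i → ∑𝟙≡𝟙∃ (λ j → good? v i j x y)
               λ g g′ → proj₂ (proj₂ (good-path-unique g g′))) ⟩
            ∑[ v < n ] ∑[ i < m ] 𝟙 (any? λ j → good? v i j x y)
          ≡⟨ (sum-cong-≗ λ v → ∑𝟙≡𝟙∃ (λ i → any? λ j → good? v i j x y)
               λ { (_ , g) (_ , g′) → proj₁ (proj₂ (good-path-unique g g′)) }) ⟩
            ∑[ v < n ] 𝟙 (any? λ i → any? λ j → good? v i j x y)
          ≡⟨ ∑𝟙≡𝟙∃ (λ v → any? λ i → any? λ j → good? v i j x y)
               (λ { (_ , _ , g) (_ , _ , g′) → proj₁ (good-path-unique g g′) }) ⟩
            𝟙 (any? λ v → any? λ i → any? λ j → good? v i j x y)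
          ≤⟨ 𝟙≤1 (any? λ v → any? λ i → any? λ j → good? v i j x y) ⟩
            1 ∎

      module LeftTargets {v i x} (v∈i : v ∈ₛ edge i) (x∈i : x ∈ₛ edge i) (x≢v : x ≢ v) where

        record Witness (y : Fin n) : Set where
          field
            j k : Fin m
            w   : Fin n
            v∈j : v ∈ₛ edge j
            i≢j : i ≢ j
            y∈j : y ∈ₛ edge j
            y≢v : y ≢ v
            w∈i : w ∈ₛ edge i
            w≢v : w ≢ v
            w≢x : w ≢ x
            w∈k : w ∈ₛ edge k
            y∈k : y ∈ₛ edge k
            k≢i : k ≢ i
        open Witness

        witness : ∀ {y} → ∃[ j ] LeftPath v i j x y → Witness y
        witness (j , ((_ , v∈j , i≢j) , _ , (y∈j , y≢v)) , (w , k , (w∈i , w≢v) , w≢x , w∈k , y∈k , k≢i)) =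
          record { j = j ; k = k ; w = w ; v∈j = v∈j ; i≢j = i≢j ; y∈j = y∈j ; y≢v = y≢v
                 ; w∈i = w∈i ; w≢v = w≢v ; w≢x = w≢x ; w∈k = w∈k ; y∈k = y∈k ; k≢i = k≢i }

        third-vertex-unique : ∀ {ya yb} (a : Witness ya) (b : Witness yb) → w a ≡ w b
        third-vertex-unique a b with w a ≟ᶠ w b
        ... | yes eq = eq
        ... | no ne  = ⊥-elim (edge-has-no-four-distinct-vertices i v∈i x∈i (w∈i a) (w∈i b)
                         (≢-sym x≢v) (≢-sym (w≢v a)) (≢-sym (w≢v b)) (≢-sym (w≢x a)) (≢-sym (w≢x b)) ne)

        edge-through-v-and-w : ∀ {y l} (a : Witness y) → v ∈ₛ edge l → w a ∈ₛ edge l → l ≡ i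
        edge-through-v-and-w a v∈l w∈l = two-common-vertices⇒≡ v∈l w∈l v∈i (w∈i a) (≢-sym (w≢v a))

        y≢w : ∀ {y} (a : Witness y) → y ≢ w a
        y≢w a refl = i≢j a (sym (edge-through-v-and-w a (v∈j a) (y∈j a)))

        two-targets-share-an-edge : ∀ {ya yb} (a : Witness ya) (b : Witness yb) → ya ≢ yb →
                                    j a ≡ j b ⊎ k a ≡ k b
        two-targets-share-an-edge {ya} {yb} a b ya≢yb with j a ≟ᶠ j b | k a ≟ᶠ k b
        ... | yes ja≡jb | _         = inj₁ ja≡jb
        ... | no _      | yes ka≡kb = inj₂ ka≡kb
        ... | no ja≢jb  | no ka≢kb  = ⊥-elim (c4-free (bergeC4 (j a) (k a) (k b) (j b)
            (≢-sym (y≢v a)) (≢-sym (w≢v a)) (≢-sym (y≢v b)) (y≢w a) ya≢yb (λ eq → y≢w b (trans (sym eq) w-same))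
            (ja≢k (w∈k a) (k≢i a)) (ja≢k w∈kb (k≢i b)) ja≢jb ka≢kb (≢-sym (jb≢k (w∈k a) (k≢i a)))
            (≢-sym (jb≢k w∈kb (k≢i b)))
            (v∈j a) (y∈j a) (y∈k a) (w∈k a) w∈kb (y∈k b) (y∈j b) (v∈j b)))
          where
          w-same : w a ≡ w b
          w-same = third-vertex-unique a b
          w∈kb : w a ∈ₛ edge (k b)
          w∈kb = subst (_∈ₛ edge (k b)) (sym w-same) (w∈k b)
          ja≢k : ∀ {l} → w a ∈ₛ edge l → l ≢ i → j a ≢ l
          ja≢k w∈l l≢i refl = l≢i (edge-through-v-and-w a (v∈j a) w∈l)
          jb≢k : ∀ {l} → w a ∈ₛ edge l → l ≢ i → j b ≢ l
          jb≢k w∈l l≢i refl = l≢i (edge-through-v-and-w a (v∈j b) w∈l)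

        no-three-targets : ∀ {y₁ y₂ y₃} → Witness y₁ → Witness y₂ → Witness y₃ →
                           y₁ ≢ y₂ → y₁ ≢ y₃ → y₂ ≢ y₃ → ⊥
        no-three-targets {y₁} {y₂} {y₃} a b c y₁≢y₂ y₁≢y₃ y₂≢y₃ =
          cases (two-targets-share-an-edge a b y₁≢y₂) (two-targets-share-an-edge a c y₁≢y₃)
                (two-targets-share-an-edge b c y₂≢y₃)
          where
          common-j : j a ≡ j b → j a ≡ j c → ⊥
          common-j ab ac = edge-has-no-four-distinct-vertices (j a) (v∈j a) (y∈j a)
            (subst (y₂ ∈ₛ_) (cong edge (sym ab)) (y∈j b)) (subst (y₃ ∈ₛ_) (cong edge (sym ac)) (y∈j c))
            (≢-sym (y≢v a)) (≢-sym (y≢v b)) (≢-sym (y≢v c)) y₁≢y₂ y₁≢y₃ y₂≢y₃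
          common-k : k a ≡ k b → k a ≡ k c → ⊥
          common-k ab ac = edge-has-no-four-distinct-vertices (k a) (w∈k a) (y∈k a)
            (subst (y₂ ∈ₛ_) (cong edge (sym ab)) (y∈k b)) (subst (y₃ ∈ₛ_) (cong edge (sym ac)) (y∈k c))
            (≢-sym (y≢w a)) (λ eq → y≢w b (trans (sym eq) (third-vertex-unique a b)))
            (λ eq → y≢w c (trans (sym eq) (third-vertex-unique a c))) y₁≢y₂ y₁≢y₃ y₂≢y₃
          cases : j a ≡ j b ⊎ k a ≡ k b → j a ≡ j c ⊎ k a ≡ k c → j b ≡ j c ⊎ k b ≡ k c → ⊥
          cases (inj₁ ab) (inj₁ ac) _          = common-j ab ac
          cases (inj₂ ab) (inj₂ ac) _          = common-k ab ac
          cases (inj₁ ab) (inj₂ ac) (inj₁ bc)  = common-j ab (trans ab bc)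
          cases (inj₁ ab) (inj₂ ac) (inj₂ bc)  = common-k (trans ac (sym bc)) ac
          cases (inj₂ ab) (inj₁ ac) (inj₁ bc)  = common-j (trans ac (sym bc)) ac
          cases (inj₂ ab) (inj₁ ac) (inj₂ bc)  = common-k ab (trans ab bc)

        at-most-two : ∑[ y < n ] 𝟙 (any? λ j → left? v i j x y) ≤ 2
        at-most-two = ∑𝟙≤2 (λ y → any? λ j → left? v i j x y)
          λ a b c → no-three-targets (witness a) (witness b) (witness c)

      left-paths-at-pair≤2 : ∀ i v x → ∑[ y < n ] ∑[ j < m ] 𝟙 (left? v i j x y)
                                ≤ 𝟙 (v ∈? edge i ×-dec otherIn? i v x) * 2
      left-paths-at-pair≤2 i v x = begin
          ∑[ y < n ] ∑[ j < m ] 𝟙 (left? v i j x y)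
        ≡⟨ (sum-cong-≗ λ y → ∑𝟙≡𝟙∃ (λ j → left? v i j x y) second-edge-unique) ⟩
          ∑[ y < n ] 𝟙 (any? λ j → left? v i j x y)
        ≤⟨ targets (v ∈? edge i ×-dec otherIn? i v x) ⟩
          𝟙 (v ∈? edge i ×-dec otherIn? i v x) * 2 ∎
        where
        open ≤-Reasoning
        second-edge-unique : ∀ {y j j′} → LeftPath v i j x y → LeftPath v i j′ x y → j ≡ j′
        second-edge-unique (((_ , v∈j , _) , _ , (y∈j , y≢v)) , _) (((_ , v∈j′ , _) , _ , (y∈j′ , _)) , _) =
          two-common-vertices⇒≡ v∈j y∈j v∈j′ y∈j′ (≢-sym y≢v)
        targets : (flag? : Dec (v ∈ₛ edge i × OtherIn i v x)) →
                  ∑[ y < n ] 𝟙 (any? λ j → left? v i j x y) ≤ 𝟙 flag? * 2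
        targets (yes (v∈i , x∈i , x≢v)) = LeftTargets.at-most-two v∈i x∈i x≢v
        targets (no ¬flag) = ≤-reflexive (∑𝟙≡0 (λ y → any? λ j → left? v i j x y)
          λ { y (_ , ((v∈i , _ , _) , x-other , _) , _) → ¬flag (v∈i , x-other) })

      #left≤m*12 : #left ≤ m * 12
      #left≤m*12 = begin
          #left
        ≡⟨ ∑⁵-by-first-edge _ ⟩
          ∑[ i < m ] ∑[ v < n ] ∑[ x < n ] ∑[ y < n ] ∑[ j < m ] 𝟙 (left? v i j x y)
        ≤⟨ (sum-mono-≤ λ i → sum-mono-≤ λ v → sum-mono-≤ λ x → left-paths-at-pair≤2 i v x) ⟩
          ∑[ i < m ] ∑[ v < n ] ∑[ x < n ] (𝟙 (v ∈? edge i ×-dec otherIn? i v x) * 2)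
        ≡⟨ (sum-cong-≗ λ i → trans
              (sum-cong-≗ λ v → sym (*-distribʳ-sum 2 λ x → 𝟙 (v ∈? edge i ×-dec otherIn? i v x)))
              (trans (sym (*-distribʳ-sum 2 λ v → ∑[ x < n ] 𝟙 (v ∈? edge i ×-dec otherIn? i v x)))
                     (cong (_* 2) (ordered-pairs-in-edge≡6 i)))) ⟩
          ∑[ i < m ] 12
        ≡⟨ sum-const m 12 ⟩
          m * 12 ∎
        where open ≤-Reasoning

      #wedges*4≤n²+24m : #wedges * 4 ≤ n * n + m * 12 + m * 12
      #wedges*4≤n²+24m = begin
          #wedges * 4                ≡⟨ #paths≡#wedges*4 ⟨
          #paths                     ≤⟨ #paths≤#good+#left+#right ⟩
          #good + #left + #right     ≤⟨ +-mono-≤ (+-mono-≤ #good≤n*n #left≤m*12)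
                                                 (subst (_≤ m * 12) (sym #right≡#left) #left≤m*12) ⟩
          n * n + m * 12 + m * 12 ∎
        where open ≤-Reasoning

      [6m]²≤n³+6n[6m] : (6 * m) * (6 * m) ≤ n * n * n + 6 * n * (6 * m)
      [6m]²≤n³+6n[6m] = begin
          (6 * m) * (6 * m)
        ≡⟨ scale m ⟩
          4 * ((m * 3) * (m * 3))
        ≡⟨ cong (λ t → 4 * (t * t)) ∑degree≡m*3 ⟨
          4 * (∑[ v < n ] degree v * ∑[ v < n ] degree v)
        ≤⟨ *-monoʳ-≤ 4 (cauchy-schwarz n degree) ⟩
          4 * (n * ∑[ v < n ] (degree v * degree v))
        ≡⟨ cong (λ t → 4 * (n * t)) ∑degree²≡m*3+#wedges ⟩
          4 * (n * (m * 3 + #wedges))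
        ≡⟨ expand n m #wedges ⟩
          12 * n * m + n * (#wedges * 4)
        ≤⟨ +-monoʳ-≤ (12 * n * m) (*-monoʳ-≤ n #wedges*4≤n²+24m) ⟩
          12 * n * m + n * (n * n + m * 12 + m * 12)
        ≡⟨ collect n m ⟩
          n * n * n + 6 * n * (6 * m) ∎
        where
        open ≤-Reasoning
        scale : ∀ m → (6 * m) * (6 * m) ≡ 4 * ((m * 3) * (m * 3))
        scale = solve-∀
        expand : ∀ n m w → 4 * (n * (m * 3 + w)) ≡ 12 * n * m + n * (w * 4)
        expand = solve-∀
        collect : ∀ n m → 12 * n * m + n * (n * n + m * 12 + m * 12) ≡ n * n * n + 6 * n * (6 * m)
        collect = solve-∀

theorem2 : (n : ℕ) (H : Hypergraph3 n) → Linear H → C4Free H →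
    BoundHolds n (numEdges H)
theorem2 n H linear c4-free =
  completing-the-square n (6 * numEdges H) ([6m]²≤n³+6n[6m] H linear c4-free)
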